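{- For any matrices $A\in\mathbb F_2^{a\times n}$ and $B\in\mathbb F_2^{b\times m}$, $\mathrm{rank}(A\dagger B)\ge\mathrm{rank}(A)\,\mathrm{rank}(B)$ (ranks over $\mathbb F_2$).
   Context: The super-slam $A\dagger B\in\mathbb F_2^{ab^n\times nm}$ is the block matrix consisting of $a$ blocks $(A\dagger B)_1,\dots,(A\dagger B)_a$, where the block $(A\dagger B)_i\in\mathbb F_2^{b^n\times nm}$ has one row for each vector $j=(j_1,\dots,j_n)\in\{1,\dots,b\}^n$, namely the row $(A_{i,1}B_{j_1},A_{i,2}B_{j_2},\dots,A_{i,n}B_{j_n})$, with $B_k$ denoting the $k$-th row of $B$ (a vector of length $m$). -}

module Defs where

open import Data.Bool using (Bool; true; false; _xor_; _∧_)
open import Data.Nat using (ℕ; zero; suc)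
open import Data.Fin using (Fin; zero; suc)
open import Data.Product using (_×_; _,_; ∃)
open import Relation.Binary.PropositionalEquality using (_≡_)
open import Relation.Nullary using (¬_)

-- The field F₂ is modelled by Bool: addition = _xor_, multiplication = _∧_.

Mat : Set → Set → Set
Mat R C = R → C → Bool

Σ₂ : (k : ℕ) → (Fin k → Bool) → Bool
Σ₂ zero    f = false
Σ₂ (suc k) f = f zero xor Σ₂ k (λ i → f (suc i))

lincomb : {C : Set} (k : ℕ) → (Fin k → Bool) → (Fin k → C → Bool) → C → Bool
lincomb k c v x = Σ₂ k (λ i → c i ∧ v i x)

LinIndep : {C : Set} (k : ℕ) → (Fin k → C → Bool) → Set
LinIndep {C} k v =
  (c : Fin k → Bool) → ((x : C) → lincomb k c v x ≡ false) → (i : Fin k) → c i ≡ false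

IsRank : {R C : Set} → Mat R C → ℕ → Set
IsRank {R} M r =
  (∃ λ (f : Fin r → R) → LinIndep r (λ i → M (f i)))
  × ((g : Fin (suc r) → R) → ¬ LinIndep (suc r) (λ i → M (g i)))

-- Rows are indexed by pairs (i , j) with i ∈ {1..a}, j ∈ {1..b}^n  (a·bⁿ rows);
-- columns by pairs (t , s) with t ∈ {1..n}, s ∈ {1..m}  (n·m columns), the
-- column (t , s) being entry s of the t-th length-m block.
slam : {a n b m : ℕ} → Mat (Fin a) (Fin n) → Mat (Fin b) (Fin m)
     → Mat (Fin a × (Fin n → Fin b)) (Fin n × Fin m)
slam A B (i , j) (t , s) = A i t ∧ B (j t) s

-- If rows u₁,…,u_p of A and v₁,…,v_q of B are independent, then the rows of A † B
-- indexed by (i , constantly j) are the Kronecker products uᵢ ⊗ vⱼ. These are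
-- independent: evaluating Σ cᵢⱼ (uᵢ ⊗ vⱼ) = 0 at column (x , y) gives
-- Σⱼ (Σᵢ cᵢⱼ uᵢ(x)) vⱼ(y) = 0, so independence of the vⱼ kills each inner sum and
-- independence of the uᵢ then kills every cᵢⱼ.
module Submission where

open import Defs
open import Algebra.Bundles using (CommutativeRing)
open import Data.Bool using (Bool; false; _∧_; _xor_)
open import Data.Bool.Properties using (xor-∧-commutativeRing; ∧-assoc)
open import Data.Fin using (Fin; zero; suc; _↑ˡ_; _↑ʳ_; splitAt; combine; remQuot)
open import Data.Fin.Properties using (splitAt-↑ˡ; splitAt-↑ʳ; remQuot-combine; combine-remQuot)
open import Data.Nat using (ℕ; zero; suc; _+_; _*_; _≤_; _≤?_)
open import Data.Nat.Properties using (≰⇒>; m≤n⇒∃[o]m+o≡n)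
open import Data.Product using (_×_; _,_; proj₁; proj₂; uncurry; map)
open import Data.Sum using (_⊎_; [_,_]′)
open import Function using (_∘_)
open import Relation.Binary.PropositionalEquality
open import Relation.Nullary using (yes; no; contradiction)

open CommutativeRing xor-∧-commutativeRing using (semiring; +-assoc; +-identityʳ)
open import Algebra.Properties.Semiring.Sum semiring
  using (sum; sum-syntax; sum-cong-≗; sum-replicate-zero; ∑-comm; *-distribʳ-sum)
open ≡-Reasoning

Σ₂≡sum : ∀ k (f : Fin k → Bool) → Σ₂ k f ≡ sum f
Σ₂≡sum zero    f = refl
Σ₂≡sum (suc k) f = cong (f zero xor_) (Σ₂≡sum k (λ i → f (suc i)))

sum-↑ : ∀ p d (h : Fin (p + d) → Bool) →
        sum h ≡ ∑[ i < p ] h (i ↑ˡ d) xor ∑[ j < d ] h (p ↑ʳ j)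
sum-↑ zero    d h = refl
sum-↑ (suc p) d h = begin
  h zero xor sum (λ k → h (suc k))
    ≡⟨ cong (h zero xor_) (sum-↑ p d (λ k → h (suc k))) ⟩
  h zero xor (∑[ i < p ] h (suc (i ↑ˡ d)) xor ∑[ j < d ] h (suc (p ↑ʳ j)))
    ≡⟨ +-assoc (h zero) _ _ ⟨
  (h zero xor ∑[ i < p ] h (suc (i ↑ˡ d))) xor ∑[ j < d ] h (suc (p ↑ʳ j)) ∎

sum-combine : ∀ p q (h : Fin (p * q) → Bool) →
              sum h ≡ ∑[ i < p ] ∑[ j < q ] h (combine i j)
sum-combine zero    q h = refl
sum-combine (suc p) q h =
  trans (sum-↑ q (p * q) h)
        (cong (∑[ j < q ] h (j ↑ˡ (p * q)) xor_) (sum-combine p q (λ k → h (q ↑ʳ k))))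

-- Coefficients are extended by zero from the first p vectors to all p + d.
LinIndep-↑ˡ : ∀ {C : Set} p d (v : Fin (p + d) → C → Bool) →
              LinIndep (p + d) v → LinIndep p (λ i → v (i ↑ˡ d))
LinIndep-↑ˡ p d v v-indep c vanish i = begin
  c i         ≡⟨ cong extend (splitAt-↑ˡ p i d) ⟨
  c′ (i ↑ˡ d) ≡⟨ v-indep c′ vanish′ (i ↑ˡ d) ⟩
  false       ∎
  where
  extend : Fin p ⊎ Fin d → Bool
  extend = [ c , (λ _ → false) ]′
  c′ : Fin (p + d) → Bool
  c′ k = extend (splitAt p k)
  vanish′ : ∀ x → lincomb (p + d) c′ v x ≡ false
  vanish′ x = begin
    lincomb (p + d) c′ v x
      ≡⟨ Σ₂≡sum (p + d) _ ⟩
    ∑[ k < p + d ] (c′ k ∧ v k x)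
      ≡⟨ sum-↑ p d _ ⟩
    ∑[ i < p ] (c′ (i ↑ˡ d) ∧ v (i ↑ˡ d) x) xor ∑[ j < d ] (c′ (p ↑ʳ j) ∧ v (p ↑ʳ j) x)
      ≡⟨ cong₂ _xor_ (sum-cong-≗ (λ i → cong (λ s → extend s ∧ v (i ↑ˡ d) x) (splitAt-↑ˡ p i d)))
                     (sum-cong-≗ (λ j → cong (λ s → extend s ∧ v (p ↑ʳ j) x) (splitAt-↑ʳ p d j))) ⟩
    ∑[ i < p ] (c i ∧ v (i ↑ˡ d) x) xor ∑[ j < d ] false
      ≡⟨ cong (∑[ i < p ] (c i ∧ v (i ↑ˡ d) x) xor_) (sum-replicate-zero d) ⟩
    ∑[ i < p ] (c i ∧ v (i ↑ˡ d) x) xor false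
      ≡⟨ +-identityʳ _ ⟩
    ∑[ i < p ] (c i ∧ v (i ↑ˡ d) x)
      ≡⟨ Σ₂≡sum p _ ⟨
    lincomb p c (λ i → v (i ↑ˡ d)) x
      ≡⟨ vanish x ⟩
    false ∎

LinIndep⇒≤rank : ∀ {R C : Set} (M : Mat R C) {r k} → IsRank M r →
                 (g : Fin k → R) → LinIndep k (λ i → M (g i)) → k ≤ r
LinIndep⇒≤rank M {r} {k} (_ , no-larger) g g-indep with k ≤? r
... | yes k≤r = k≤r
... | no  k≰r with m≤n⇒∃[o]m+o≡n (≰⇒> k≰r)
...   | d , refl = contradiction (LinIndep-↑ˡ (suc r) d (λ i → M (g i)) g-indep)
                                 (no-larger (λ i → g (i ↑ˡ d)))

_⊗_ : ∀ {p q} {X Y : Set} → (Fin p → X → Bool) → (Fin q → Y → Bool) →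
      Fin (p * q) → X × Y → Bool
_⊗_ {p} {q} u v k (x , y) = u (proj₁ (remQuot {p} q k)) x ∧ v (proj₂ (remQuot {p} q k)) y

⊗-combine : ∀ {p q} {X Y : Set} (u : Fin p → X → Bool) (v : Fin q → Y → Bool) i j x y →
            (u ⊗ v) (combine i j) (x , y) ≡ u i x ∧ v j y
⊗-combine {q = q} u v i j x y =
  cong (λ ij → u (proj₁ ij) x ∧ v (proj₂ ij) y) (remQuot-combine {k = q} i j)

lincomb-⊗ : ∀ p q {X Y : Set} (c : Fin (p * q) → Bool)
            (u : Fin p → X → Bool) (v : Fin q → Y → Bool) x y →
            lincomb (p * q) c (u ⊗ v) (x , y)
            ≡ lincomb q (λ j → lincomb p (λ i → c (combine i j)) u x) v y
lincomb-⊗ p q c u v x y = begin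
  lincomb (p * q) c (u ⊗ v) (x , y)
    ≡⟨ Σ₂≡sum (p * q) _ ⟩
  ∑[ k < p * q ] (c k ∧ (u ⊗ v) k (x , y))
    ≡⟨ sum-combine p q _ ⟩
  ∑[ i < p ] ∑[ j < q ] (C i j ∧ (u ⊗ v) (combine i j) (x , y))
    ≡⟨ sum-cong-≗ (λ i → sum-cong-≗ (λ j → regroup i j)) ⟩
  ∑[ i < p ] ∑[ j < q ] ((C i j ∧ u i x) ∧ v j y)
    ≡⟨ ∑-comm (λ i j → (C i j ∧ u i x) ∧ v j y) ⟩
  ∑[ j < q ] ∑[ i < p ] ((C i j ∧ u i x) ∧ v j y)
    ≡⟨ sum-cong-≗ (λ j → *-distribʳ-sum (v j y) (λ i → C i j ∧ u i x)) ⟨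
  ∑[ j < q ] (∑[ i < p ] (C i j ∧ u i x) ∧ v j y)
    ≡⟨ sum-cong-≗ (λ j → cong (_∧ v j y) (Σ₂≡sum p _)) ⟨
  ∑[ j < q ] (lincomb p (λ i → C i j) u x ∧ v j y)
    ≡⟨ Σ₂≡sum q _ ⟨
  lincomb q (λ j → lincomb p (λ i → C i j) u x) v y ∎
  where
  C : Fin p → Fin q → Bool
  C i j = c (combine i j)
  regroup : ∀ i j → C i j ∧ (u ⊗ v) (combine i j) (x , y) ≡ (C i j ∧ u i x) ∧ v j y
  regroup i j = trans (cong (C i j ∧_) (⊗-combine u v i j x y)) (sym (∧-assoc (C i j) _ _))

LinIndep-⊗ : ∀ {p q} {X Y : Set} {u : Fin p → X → Bool} {v : Fin q → Y → Bool} →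
             LinIndep p u → LinIndep q v → LinIndep (p * q) (u ⊗ v)
LinIndep-⊗ {p} {q} {u = u} {v} u-indep v-indep c vanish k = begin
  c k                                   ≡⟨ cong c (combine-remQuot {p} q k) ⟨
  c (uncurry combine (remQuot {p} q k)) ≡⟨ coefficient-vanishes (remQuot {p} q k) ⟩
  false                                 ∎
  where
  coefficient-vanishes : (ij : Fin p × Fin q) → c (uncurry combine ij) ≡ false
  coefficient-vanishes (i , j) =
    u-indep (λ i → c (combine i j))
            (λ x → v-indep _ (λ y → trans (sym (lincomb-⊗ p q c u v x y)) (vanish (x , y))) j)
            i

propositionA5 : (a n b m : ℕ) (A : Mat (Fin a) (Fin n)) (B : Mat (Fin b) (Fin m))
    (rA rB rAB : ℕ) → IsRank A rA → IsRank B rB → IsRank (slam A B) rAB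
    → rA * rB ≤ rAB
propositionA5 a n b m A B rA rB rAB ((f , A-indep) , _) ((g , B-indep) , _) slam-rank =
  LinIndep⇒≤rank (slam A B) slam-rank tensorRows (LinIndep-⊗ A-indep B-indep)
  where
  -- Row (f i , constantly g j) of A † B is the Kronecker product of Aᶠ⁽ⁱ⁾ and Bᵍ⁽ʲ⁾.
  tensorRows : Fin (rA * rB) → Fin a × (Fin n → Fin b)
  tensorRows = map f (λ j _ → g j) ∘ remQuot {rA} rB
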